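{- Let $\Sigma$ be a finite alphabet, let $x\in\Sigma^*$ be a nonempty word and $\tilde{x}$ its circularization. Then $$\mathcal{M}_{\mathcal{F}_{\tilde{x}^*}}=\mathcal{M}_{\mathcal{F}_{\tilde{x}}}\cap \Sigma^{\le |x|}.$$
   Context: For a factorial language $L\subseteq\Sigma^*$ (one closed under taking factors), its set of minimal absent words is $\mathcal{M}_L=\{aub\mid a,b\in\Sigma,\ u\in\Sigma^*,\ aub\notin L,\ au\in L,\ ub\in L\}$. For a word $x$ of length $m$, $x^{\langle i\rangle}=x[i\,..\,m-1]x[0\,..\,i-1]$ is its $i$-th rotation; the circular word $\tilde{x}$ is the class of all rotations of $x$. $\mathcal{F}_{\tilde{x}}$ is the set of factors of $xx$ of length at most $|x|$. $\mathcal{F}_{\tilde{x}^*}$ is the set of all factors of words in $x^*=\{x^k\mid k\ge 0\}$ (this does not depend on the chosen rotation $x$). $\Sigma^{\le |x|}$ is the set of words of length at most $|x|$. -}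

module Defs where

open import Data.Nat using (ℕ; _≤_)
open import Data.List using (List; []; _∷_; _++_; [_]; length; concat; replicate)
open import Data.Product using (Σ; ∃; _×_)
open import Relation.Binary.PropositionalEquality using (_≡_)
open import Relation.Nullary using (¬_)

Language : Set → Set₁
Language A = List A → Set

_IsFactorOf_ : {A : Set} → List A → List A → Set
_IsFactorOf_ {A} u w = Σ (List A) λ p → Σ (List A) λ s → p ++ u ++ s ≡ w

_^ʷ_ : {A : Set} → List A → ℕ → List A
x ^ʷ n = concat (replicate n x)

-- F_{x~}: factors of xx of length at most |x|
FactCirc : {A : Set} → List A → Language A
FactCirc x w = (w IsFactorOf (x ++ x)) × (length w ≤ length x)

-- F_{x~*}: factors of words in x* = { x^k | k ≥ 0 }
FactStar : {A : Set} → List A → Language A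
FactStar x w = ∃ λ (k : ℕ) → w IsFactorOf (x ^ʷ k)

MAW : {A : Set} → Language A → Language A
MAW {A} L w = Σ A λ a → Σ (List A) λ u → Σ A λ b →
  (w ≡ a ∷ (u ++ [ b ])) × (¬ L w) × L (a ∷ u) × L (u ++ [ b ])

module Submission where

-- Fix a nonempty word x of length m and read it as the infinite periodic
-- word ω with ω(n) = x[n mod m].  Both languages are described by
-- occurrences in ω: a word is a factor of some x^k iff it occurs somewhere
-- in ω, and it is a factor of xx of length ≤ m iff it occurs in ω and has
-- length ≤ m.  Hence F(x~) = F(x~*) ∩ Σ^{≤m}, which settles the theorem for
-- words of length ≤ m.  The remaining point is that no word a·u·b with
-- |u| ≥ m − 1 is minimal absent from F(x~*): if a·u occurs at i and u·b
-- occurs somewhere, then the letter after a·u at i is b.  This follows from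
-- an orbit argument (shift-invariant) about periodic functions that are
-- invariant under a shift except on a single residue class.

open import Defs
open import Data.Nat using (ℕ; zero; suc; pred; _+_; _*_; _≤_; _<_; s≤s; s≤s⁻¹; _≟_; _≤?_; NonZero)
open import Data.Nat.Properties
  using (+-identityʳ; ≤-reflexive; +-assoc; +-comm; +-suc; *-comm; suc-pred; ≤-trans; <⇒≤; ≤∧≢⇒<; ≰⇒>; n≤1+n; m≤m*n; +-mono-≤; module ≤-Reasoning)
open import Data.Nat.DivMod using (_%_; %-distribˡ-+; [m+kn]%n≡m%n; m%n%n≡m%n; m%n<n; m<n⇒m%n≡m; n%n≡0)
open import Data.Nat.Tactic.RingSolver using (solve-∀)
open import Data.Fin using (Fin)
open import Data.List using (List; []; _∷_; _++_; [_]; length)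
open import Data.List.Properties using (length-++; length-++-≤ˡ; length-++-sucʳ; ++-assoc)
open import Data.Maybe using (Maybe; just; nothing)
open import Data.Maybe.Properties using (just-injective)
open import Data.Product using (Σ; _×_; _,_; proj₁; proj₂)
open import Data.Sum using (_⊎_; inj₁; inj₂)
open import Data.Unit using (⊤; tt)
open import Data.Empty using (⊥-elim)
open import Relation.Nullary using (yes; no)
open import Relation.Binary.PropositionalEquality
  using (_≡_; _≢_; refl; sym; trans; cong; cong₂; subst; module ≡-Reasoning)
open import Function.Bundles using (_⇔_; mk⇔)

Periodic : {B : Set} (m : ℕ) .{{_ : NonZero m}} → (ℕ → B) → Set
Periodic m g = ∀ a b → a % m ≡ b % m → g a ≡ g b

%-cong-+ : ∀ m {a b c e} .{{_ : NonZero m}} →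
  a % m ≡ b % m → c % m ≡ e % m → (a + c) % m ≡ (b + e) % m
%-cong-+ m {a} {b} {c} {e} a≡b c≡e = begin
  (a + c) % m          ≡⟨ %-distribˡ-+ a c m ⟩
  (a % m + c % m) % m  ≡⟨ cong₂ (λ r s → (r + s) % m) a≡b c≡e ⟩
  (b % m + e % m) % m  ≡⟨ %-distribˡ-+ b e m ⟨
  (b + e) % m          ∎
  where open ≡-Reasoning

-- If g is m-periodic and the shift by d preserves g at every
-- position outside one residue class r, it preserves g everywhere: along the
-- orbit L, L + d, L + 2d, … every step is harmless until the orbit re-enters
-- class r, which happens at the latest after m steps, back in the class of L.
shift-invariant : {B : Set} {m : ℕ} .{{_ : NonZero m}} (g : ℕ → B) (r d : ℕ) →
  Periodic m g → (∀ t → t % m ≢ r → g t ≡ g (t + d)) → ∀ L → g L ≡ g (L + d)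
shift-invariant {m = m} g r d periodic step L with L % m ≟ r
... | no  L≢r = step L L≢r
... | yes L≡r = sym (close (walk (pred m)))
  where
  -- After n + 1 steps we either still see the value g (L + d) or have
  -- already come back to the class r (and thus to the value g L).
  walk : ∀ n → g (L + d) ≡ g (L + suc n * d) ⊎ g (L + d) ≡ g L
  walk zero = inj₁ (cong (λ e → g (L + e)) (sym (+-identityʳ d)))
  walk (suc n) with walk n
  ... | inj₂ back = inj₂ back
  ... | inj₁ same with (L + suc n * d) % m ≟ r
  ...   | yes hit  = inj₂ (trans same (periodic _ L (trans hit (sym L≡r))))
  ...   | no  miss = inj₁ (trans same (trans (step _ miss) (cong g next)))
    where
    next : L + suc n * d + d ≡ L + suc (suc n) * d
    next = trans (+-assoc L (suc n * d) d) (cong (L +_) (+-comm (suc n * d) d))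

  -- After m steps the orbit is back in the class of L.
  close : g (L + d) ≡ g (L + suc (pred m) * d) ⊎ g (L + d) ≡ g L → g (L + d) ≡ g L
  close (inj₂ back) = back
  close (inj₁ same) = trans same (periodic _ L full-turn)
    where
    full-turn : (L + suc (pred m) * d) % m ≡ L % m
    full-turn = trans (cong (λ k → (L + k) % m) (trans (cong (_* d) (suc-pred m)) (*-comm m d)))
                      ([m+kn]%n≡m%n L d m)

nth : {A : Set} → List A → ℕ → Maybe A
nth []      _       = nothing
nth (c ∷ v) zero    = just c
nth (c ∷ v) (suc n) = nth v n

nth-++ : {A : Set} (p : List A) (c : A) (v : List A) → nth (p ++ c ∷ v) (length p) ≡ just c
nth-++ []      c v = refl
nth-++ (d ∷ p) c v = nth-++ p c v

length-snoc : {A : Set} (u : List A) (b : A) → length (u ++ [ b ]) ≡ suc (length u)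
length-snoc u b = trans (length-++ u) (+-comm (length u) 1)

module InfinitePower {A : Set} (c : A) (xs : List A) where

  x : List A
  x = c ∷ xs

  m : ℕ
  m = length x

  ω : ℕ → Maybe A
  ω n = nth x (n % m)

  ω-periodic : Periodic m ω
  ω-periodic a b a≡b = cong (nth x) a≡b

  OccursAt : List A → ℕ → Set
  OccursAt []      i = ⊤
  OccursAt (a ∷ w) i = ω i ≡ just a × OccursAt w (suc i)

  Occurs : List A → Set
  Occurs w = Σ ℕ (OccursAt w)

  occurs-mod : ∀ w {i j} → i % m ≡ j % m → OccursAt w i → OccursAt w j
  occurs-mod []      i≡j _            = tt
  occurs-mod (a ∷ w) {i} {j} i≡j (ωi≡a , occ-w) =
    trans (ω-periodic j i (sym i≡j)) ωi≡a , occurs-mod w (%-cong-+ m {a = 1} {b = 1} {c = i} {e = j} refl i≡j) occ-w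

  occurs-++ : ∀ v y i → OccursAt v i → OccursAt y (length v + i) → OccursAt (v ++ y) i
  occurs-++ []      y i _            occ-y = occ-y
  occurs-++ (a ∷ v) y i (ωi≡a , occ-v) occ-y =
    ωi≡a , occurs-++ v y (suc i) occ-v (subst (OccursAt y) (sym (+-suc (length v) i)) occ-y)

  occurs-++⁻ : ∀ v y i → OccursAt (v ++ y) i → OccursAt v i × OccursAt y (length v + i)
  occurs-++⁻ []      y i occ-vy           = tt , occ-vy
  occurs-++⁻ (a ∷ v) y i (ωi≡a , occ-vy) with occurs-++⁻ v y (suc i) occ-vy
  ... | occ-v , occ-y = (ωi≡a , occ-v) , subst (OccursAt y) (+-suc (length v) i) occ-y

  occurs-factor : ∀ p w s {i} → OccursAt (p ++ w ++ s) i → OccursAt w (length p + i)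
  occurs-factor p w s {i} occ-pws = proj₁ (occurs-++⁻ w s _ (proj₂ (occurs-++⁻ p (w ++ s) i occ-pws)))

  suffix-occurs : ∀ p v → p ++ v ≡ x → OccursAt v (length p)
  suffix-occurs p []      _     = tt
  suffix-occurs p (a ∷ v) p·av≡x =
    ω|p|≡a , subst (OccursAt v) (length-snoc p a) (suffix-occurs (p ++ [ a ]) v (trans (++-assoc p [ a ] v) p·av≡x))
    where
    |p|<m : length p < m
    |p|<m = begin-strict
      length p               <⟨ s≤s (length-++-≤ˡ p) ⟩
      suc (length (p ++ v))  ≡⟨ length-++-sucʳ p a v ⟨
      length (p ++ a ∷ v)    ≡⟨ cong length p·av≡x ⟩
      m                      ∎
      where open ≤-Reasoning
    ω|p|≡a : ω (length p) ≡ just a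
    ω|p|≡a = trans (cong (nth x) (m<n⇒m%n≡m |p|<m)) (trans (cong (λ z → nth z (length p)) (sym p·av≡x)) (nth-++ p a v))

  occurs-x : OccursAt x 0
  occurs-x = suffix-occurs [] x refl

  occurs-after-x : ∀ v → OccursAt v 0 → OccursAt (x ++ v) 0
  occurs-after-x v occ-v = occurs-++ x v 0 occurs-x (occurs-mod v one-period occ-v)
    where
    one-period : 0 % m ≡ (m + 0) % m
    one-period = sym (%-cong-+ m {a = m} {b = 0} {c = 0} {e = 0} (n%n≡0 m) refl)

  occurs-pow : ∀ k → OccursAt (x ^ʷ k) 0
  occurs-pow zero    = tt
  occurs-pow (suc k) = occurs-after-x (x ^ʷ k) (occurs-pow k)

  occurs-xx : OccursAt (x ++ x) 0
  occurs-xx = occurs-after-x x occurs-x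

  length-pow : ∀ k → length (x ^ʷ k) ≡ k * m
  length-pow zero    = refl
  length-pow (suc k) = trans (length-++ x) (cong (m +_) (length-pow k))

  occurs-prefix : ∀ w W {j} → OccursAt w j → OccursAt W j → length w ≤ length W →
    Σ (List A) λ s → w ++ s ≡ W
  occurs-prefix []      W       _                _                _         = W , refl
  occurs-prefix (a ∷ w) (b ∷ W) (ωj≡a , occ-w) (ωj≡b , occ-W) (s≤s |w|≤|W|)
    with occurs-prefix w W occ-w occ-W |w|≤|W|
  ... | s , w·s≡W = s , cong₂ _∷_ (just-injective (trans (sym ωj≡a) ωj≡b)) w·s≡W

  occurs-inside : ∀ d w W {j} → OccursAt w (d + j) → OccursAt W j → d + length w ≤ length W →
    w IsFactorOf W
  occurs-inside zero w W occ-w occ-W fits with occurs-prefix w W occ-w occ-W fits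
  ... | s , w·s≡W = [] , s , w·s≡W
  occurs-inside (suc d) w (b ∷ W) {j} occ-w (_ , occ-W) (s≤s fits)
    with occurs-inside d w W (subst (OccursAt w) (sym (+-suc d j)) occ-w) occ-W fits
  ... | p , s , p·w·s≡W = b ∷ p , s , cong (b ∷_) p·w·s≡W

  star⇒occurs : ∀ {w} → FactStar x w → Occurs w
  star⇒occurs {w} (k , p , s , p·w·s≡x^k) =
    length p + 0 , occurs-factor p w s (subst (λ W → OccursAt W 0) (sym p·w·s≡x^k) (occurs-pow k))

  occurs⇒star : ∀ {w} → Occurs w → FactStar x w
  occurs⇒star {w} (i , occ-w) =
    k , occurs-inside i w (x ^ʷ k) (subst (OccursAt w) (sym (+-identityʳ i)) occ-w) (occurs-pow k) fits
    where
    k : ℕ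
    k = i + length w
    fits : i + length w ≤ length (x ^ʷ k)
    fits = ≤-trans (m≤m*n k m) (≤-reflexive (sym (length-pow k)))

  circ⇒occurs : ∀ {w} → FactCirc x w → Occurs w
  circ⇒occurs {w} ((p , s , p·w·s≡xx) , _) =
    length p + 0 , occurs-factor p w s (subst (λ W → OccursAt W 0) (sym p·w·s≡xx) occurs-xx)

  occurs⇒circ : ∀ {w} → Occurs w → length w ≤ m → FactCirc x w
  occurs⇒circ {w} (i , occ-w) |w|≤m =
    occurs-inside (i % m) w (x ++ x) occ-w' occurs-xx fits , |w|≤m
    where
    occ-w' : OccursAt w (i % m + 0)
    occ-w' = subst (OccursAt w) (sym (+-identityʳ (i % m))) (occurs-mod w (sym (m%n%n≡m%n i m)) occ-w)
    fits : i % m + length w ≤ length (x ++ x)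
    fits = ≤-trans (+-mono-≤ (<⇒≤ (m%n<n i m)) |w|≤m) (≤-reflexive (sym (length-++ x)))

  occurrences-agree : ∀ u {i j} → OccursAt u i → OccursAt u j →
    ∀ t → t < length u → ω (t + i) ≡ ω (t + j)
  occurrences-agree (a ∷ u) (ωi≡a , _) (ωj≡a , _) zero _ = trans ωi≡a (sym ωj≡a)
  occurrences-agree (a ∷ u) {i} {j} (_ , occ-i) (_ , occ-j) (suc t) (s≤s t<|u|) =
    trans (cong ω (sym (+-suc t i)))
          (trans (occurrences-agree u occ-i occ-j t t<|u|) (cong ω (+-suc t j)))

  shift-arith : ∀ t j i n → t + (j + n * suc i) + suc i ≡ (t + j) + suc i * suc n
  shift-arith = solve-∀

  -- The letters g t = ω (t + i + 1) after a are related
  -- to the letters of ω after j by a shift d; they agree on the m − 1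
  -- residues covered by u, hence by the orbit lemma on every residue, in
  -- particular at |u|, where the occurrence at j shows the letter b.
  extend-occurrence : ∀ a u b {i} → length xs ≤ length u →
    OccursAt (a ∷ u) i → Occurs (u ++ [ b ]) → OccursAt (a ∷ u ++ [ b ]) i
  extend-occurrence a u b {i} long (ωi≡a , occ-u) (j , occ-ub) with occurs-++⁻ u [ b ] j occ-ub
  ... | occ-u' , (ω≡b , tt) = ωi≡a , occurs-++ u [ b ] (suc i) occ-u (b-follows , tt)
    where
    open ≡-Reasoning

    g : ℕ → Maybe A
    g t = ω (t + suc i)

    d : ℕ
    d = j + length xs * suc i

    g-periodic : Periodic m g
    g-periodic s t s≡t = ω-periodic (s + suc i) (t + suc i) (%-cong-+ m {a = s} {b = t} {c = suc i} {e = suc i} s≡t refl)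

    shift : ∀ t → ω (t + j) ≡ g (t + d)
    shift t = ω-periodic (t + j) (t + d + suc i) (sym (trans (cong (_% m) (shift-arith t j i (length xs)))
                                         ([m+kn]%n≡m%n (t + j) (suc i) m)))

    -- Off the last residue class, t mod m indexes a letter of u.
    g-step : ∀ t → t % m ≢ length xs → g t ≡ g (t + d)
    g-step t t≢last = begin
      g t            ≡⟨ g-periodic t (t % m) (sym (m%n%n≡m%n t m)) ⟩
      g (t % m)      ≡⟨ occurrences-agree u occ-u occ-u' (t % m) t%m<|u| ⟩
      ω (t % m + j)  ≡⟨ shift (t % m) ⟩
      g (t % m + d)  ≡⟨ g-periodic (t % m + d) (t + d) (%-cong-+ m {a = t % m} {b = t} {c = d} {e = d} (m%n%n≡m%n t m) refl) ⟩
      g (t + d)      ∎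
      where
      t%m<|u| : t % m < length u
      t%m<|u| = ≤-trans (≤∧≢⇒< (s≤s⁻¹ (m%n<n t m)) t≢last) long

    b-follows : ω (length u + suc i) ≡ just b
    b-follows = begin
      g (length u)      ≡⟨ shift-invariant g (length xs) d g-periodic g-step (length u) ⟩
      g (length u + d)  ≡⟨ shift (length u) ⟨
      ω (length u + j)  ≡⟨ ω≡b ⟩
      just b            ∎

  circ⊆star : ∀ {w} → FactCirc x w → FactStar x w
  circ⊆star w∈ = occurs⇒star (circ⇒occurs w∈)

  short-star⊆circ : ∀ {w} → FactStar x w → length w ≤ m → FactCirc x w
  short-star⊆circ w∈ = occurs⇒circ (star⇒occurs w∈)

  star-extend : ∀ a u b → length xs ≤ length u →
    FactStar x (a ∷ u) → FactStar x (u ++ [ b ]) → FactStar x (a ∷ u ++ [ b ])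
  star-extend a u b long au∈ ub∈ with star⇒occurs au∈
  ... | i , occ-au = occurs⇒star (i , extend-occurrence a u b long occ-au (star⇒occurs ub∈))

  -- A minimal absent word of F(x~*) has length ≤ m, since longer words a·u·b
  -- with a·u, u·b ∈ F(x~*) lie in F(x~*); it is then minimal absent for F(x~).
  maw-star⇒maw-circ : ∀ {w} → MAW (FactStar x) w → MAW (FactCirc x) w × length w ≤ m
  maw-star⇒maw-circ (a , u , b , refl , absent , au∈ , ub∈) with length (a ∷ u ++ [ b ]) ≤? m
  ... | no  too-long = ⊥-elim (absent (star-extend a u b long au∈ ub∈))
    where
    long : length xs ≤ length u
    long = s≤s⁻¹ (subst (m ≤_) (length-snoc u b) (s≤s⁻¹ (≰⇒> too-long)))
  ... | yes short =
    (a , u , b , refl , (λ w∈ → absent (circ⊆star w∈)) ,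
      short-star⊆circ au∈ (≤-trans (s≤s (length-++-≤ˡ u)) short) ,
      short-star⊆circ ub∈ (≤-trans (n≤1+n _) short)) , short

  maw-circ⇒maw-star : ∀ {w} → MAW (FactCirc x) w × length w ≤ m → MAW (FactStar x) w
  maw-circ⇒maw-star ((a , u , b , refl , absent , au∈ , ub∈) , short) =
    a , u , b , refl , (λ w∈ → absent (short-star⊆circ w∈ short)) , circ⊆star au∈ , circ⊆star ub∈

lemma3 : (k : ℕ) (x : List (Fin k)) → x ≢ [] →
    (w : List (Fin k)) →
      MAW (FactStar x) w ⇔ (MAW (FactCirc x) w × length w ≤ length x)
lemma3 k []       x≢[] w = ⊥-elim (x≢[] refl)
lemma3 k (c ∷ xs) _    w = mk⇔ maw-star⇒maw-circ maw-circ⇒maw-star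
  where open InfinitePower c xs
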